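{- Let $G$ be a strongly regular graph with parameters $(n,k,\lambda,\mu)$ where $\mu\geq 1$, and suppose $G$ is not a star. Then $rc(G)\leq 5$.
   Context: All graphs are finite, simple and undirected. A simple graph $G$ which is neither empty (edgeless) nor complete is strongly regular with parameters $(n,k,\lambda,\mu)$ if $|V(G)|=n$, $G$ is $k$-regular, any two adjacent vertices have exactly $\lambda$ common neighbors, and any two nonadjacent vertices have exactly $\mu$ common neighbors. A star is a complete bipartite graph $K_{1,t}$. In an edge-colored graph (adjacent edges may receive the same color), a path is a rainbow path if no two of its edges have the same color. The rainbow connection number $rc(G)$ of a connected graph $G$ is the minimum integer $i$ such that there is an edge-coloring of $G$ with $i$ colors in which every two distinct vertices of $G$ are connected by a rainbow path. -}

module Defs where

open import Data.Nat using (ℕ; zero; suc; _+_; _≤_)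
open import Data.Fin using (Fin)
open import Data.Bool using (Bool; true; false; _∧_; if_then_else_)
open import Data.List using (List; []; _∷_; _++_)
open import Data.List.Relation.Unary.Unique.Propositional using (Unique)
open import Data.Product using (Σ; ∃; ∃-syntax; _×_; _,_)
open import Data.Sum using (_⊎_)
open import Data.Unit using (⊤)
open import Relation.Binary.PropositionalEquality using (_≡_; _≢_)
open import Relation.Nullary using (¬_)

record Graph (n : ℕ) : Set where
  field
    adj   : Fin n → Fin n → Bool
    sym   : ∀ u v → adj u v ≡ adj v u
    irrefl : ∀ v → adj v v ≡ false
open Graph public

count : ∀ {n} → (Fin n → Bool) → ℕ
count {zero}  p = 0
count {suc n} p = (if p Fin.zero then 1 else 0) + count (λ i → p (Fin.suc i))

Adjacent : ∀ {n} → Graph n → Fin n → Fin n → Set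
Adjacent G u v = adj G u v ≡ true

degree : ∀ {n} → Graph n → Fin n → ℕ
degree G v = count (adj G v)

commonNeighbours : ∀ {n} → Graph n → Fin n → Fin n → ℕ
commonNeighbours G u v = count (λ w → adj G u w ∧ adj G v w)

IsEmptyGraph : ∀ {n} → Graph n → Set
IsEmptyGraph G = ∀ u v → ¬ Adjacent G u v

IsComplete : ∀ {n} → Graph n → Set
IsComplete G = ∀ u v → u ≢ v → Adjacent G u v

IsStronglyRegular : ∀ {n} → Graph n → ℕ → ℕ → ℕ → Set
IsStronglyRegular G k l m =
    ¬ IsEmptyGraph G
  × ¬ IsComplete G
  × (∀ v → degree G v ≡ k)
  × (∀ u v → u ≢ v → Adjacent G u v → commonNeighbours G u v ≡ l)
  × (∀ u v → u ≢ v → ¬ Adjacent G u v → commonNeighbours G u v ≡ m)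

IsStar : ∀ {n} → Graph n → Set
IsStar G = ∃[ c ] ((∀ v → v ≢ c → Adjacent G c v)
                 × (∀ u v → Adjacent G u v → u ≡ c ⊎ v ≡ c))

-- An edge-colouring with k colours: a symmetric colour assignment
-- (values on non-edges are irrelevant).
record EdgeColouring {n} (G : Graph n) (k : ℕ) : Set where
  field
    col    : Fin n → Fin n → Fin k
    colSym : ∀ u v → col u v ≡ col v u
open EdgeColouring public

Walk : ∀ {n} → Graph n → List (Fin n) → Set
Walk G []           = ⊤
Walk G (x ∷ [])     = ⊤
Walk G (x ∷ y ∷ r)  = Adjacent G x y × Walk G (y ∷ r)

edgeColours : ∀ {n k} {G : Graph n} → EdgeColouring G k → List (Fin n) → List (Fin k)
edgeColours c []          = []
edgeColours c (x ∷ [])    = []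
edgeColours c (x ∷ y ∷ r) = col c x y ∷ edgeColours c (y ∷ r)

RainbowPath : ∀ {n k} {G : Graph n} → EdgeColouring G k → Fin n → Fin n → Set
RainbowPath {G = G} c u v =
  ∃[ mid ] (let ps = u ∷ (mid ++ v ∷ []) in
            Unique ps × Walk G ps × Unique (edgeColours c ps))

RainbowConnecting : ∀ {n k} {G : Graph n} → EdgeColouring G k → Set
RainbowConnecting {n} c = ∀ (u v : Fin n) → u ≢ v → RainbowPath c u v

-- rc(G) ≤ r : rc(G) is the least i admitting a rainbow-connecting
-- colouring with i colours, so rc(G) ≤ r iff some i ≤ r admits one.
rc≤ : ∀ {n} → Graph n → ℕ → Set
rc≤ G r = ∃[ i ] (i ≤ r × Σ (EdgeColouring G i) RainbowConnecting)

module Submission where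

-- Since G is not complete, fix a vertex v with a non-neighbour.  Every vertex
-- other than v is "inner" (adjacent to v) or "outer"; μ ≥ 1 makes every outer
-- vertex adjacent to an inner one.  We colour the spokes v–a by a side of a
-- (two colours), the inner–outer edges by two tints, and all other edges by a
-- fifth colour, and exhibit rainbow walks between all pairs of vertices; loop
-- erasure turns rainbow walks into rainbow paths.  Two choices of sides and
-- tints cover all parameters:
--   * μ = 1 or λ = 0: tint an edge by the side of its inner end, with sides
--     chosen so that every outer vertex reaches both sides within two steps;
--   * λ ≥ 1, μ ≥ 2: sides from Ore's lemma (every inner vertex gets an inner
--     neighbour on the other side) and each outer vertex tints one chosen
--     inner neighbour differently from the others.

open import Defs hiding (sym)
open Defs using () renaming (sym to adj-comm)
open import Data.Nat using (ℕ; zero; suc; _+_; _≤_; _<_; _≥_; z≤n; s≤s)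
  renaming (_≟_ to _≟ℕ_)
open import Data.Nat.Properties using (+-suc; ≤-trans; n≤1+n; ≤-pred; ≤-refl; +-monoˡ-≤; +-cancelˡ-≡; ≤∧≢⇒<; n≢0⇒n>0)
open import Data.Fin using (Fin; zero; suc)
open import Data.Fin.Properties using (_≟_; suc-injective; any?; all?; ¬∀⟶∃¬)
open import Data.Bool using (Bool; true; false; _∧_; _∨_; not)
open import Data.Bool.Properties using (∧-conicalˡ; ∧-conicalʳ; not-injective; ∨-zeroʳ; ¬-not)
  renaming (_≟_ to _≟ᴮ_)
open import Data.Product using (Σ; ∃-syntax; _×_; _,_; proj₁; proj₂)
open import Data.Sum using (_⊎_; inj₁; inj₂)
open import Data.Unit using (tt)
open import Data.Empty using (⊥; ⊥-elim)
open import Data.List using (List; []; _∷_; _++_; reverse; reverseAcc)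
open import Data.List.Properties using (++-assoc; unfold-reverse; reverse-++)
open import Data.List.Relation.Unary.All using ([]; _∷_)
open import Data.List.Relation.Unary.All.Properties using (¬Any⇒All¬) renaming (++⁺ to All-++⁺)
open import Data.List.Relation.Unary.AllPairs using ([]; _∷_)
open import Data.List.Relation.Unary.Unique.Propositional using (Unique)
open import Data.List.Relation.Unary.Unique.DecPropositional (_≟_ {5}) using (unique?)
open import Data.List.Relation.Binary.Pointwise using (Pointwise; []; _∷_; Pointwise-≡⇒≡)
open import Data.List.Relation.Binary.Sublist.Propositional using (_⊆_; []; _∷_; _∷ʳ_; ⊆-refl; ⊆-trans; minimum)
open import Data.List.Relation.Binary.Sublist.Propositional.Properties using (All-resp-⊆)
open import Data.List.Relation.Binary.Permutation.Propositional using (↭-sym; ↭⇒↭ₛ)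
import Data.List.Relation.Binary.Permutation.Propositional.Properties as Perm↭
import Data.List.Relation.Binary.Permutation.Setoid.Properties as Perm
open import Data.List.Membership.Propositional.Properties using (∈-∃++)
open import Relation.Binary.PropositionalEquality
open import Relation.Nullary using (¬_; Dec; yes; no; does; _→-dec_; _⊎-dec_; _×-dec_; ¬?)
open import Relation.Nullary.Decidable using (True; toWitness; dec-true; dec-false)

count-witness : ∀ {n} (p : Fin n → Bool) → 1 ≤ count p → ∃[ i ] p i ≡ true
count-witness {suc n} p h with p zero in p0
... | true = zero , p0
... | false with count-witness (λ i → p (suc i)) h
... | i , pi = suc i , pi

witness-count : ∀ {n} (p : Fin n → Bool) {i} → p i ≡ true → 1 ≤ count p
witness-count {suc n} p {zero} pi rewrite pi = s≤s z≤n
witness-count {suc n} p {suc i} pi with p zero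
... | true = s≤s z≤n
... | false = witness-count (λ j → p (suc j)) pi

witnesses-count : ∀ {n} (p : Fin n → Bool) {i j} → i ≢ j → p i ≡ true → p j ≡ true → 2 ≤ count p
witnesses-count {suc n} p {zero} {zero} i≢j _ _ = ⊥-elim (i≢j refl)
witnesses-count {suc n} p {zero} {suc j} _ pi pj rewrite pi = s≤s (witness-count (λ k → p (suc k)) pj)
witnesses-count {suc n} p {suc i} {zero} _ pi pj rewrite pj = s≤s (witness-count (λ k → p (suc k)) pi)
witnesses-count {suc n} p {suc i} {suc j} i≢j pi pj with p zero
... | true = ≤-trans (witnesses-count (λ k → p (suc k)) (λ e → i≢j (cong suc e)) pi pj) (n≤1+n _)
... | false = witnesses-count (λ k → p (suc k)) (λ e → i≢j (cong suc e)) pi pj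

count-other : ∀ {n} (p : Fin n → Bool) → 2 ≤ count p → ∀ j → ∃[ i ] (i ≢ j × p i ≡ true)
count-other {suc n} p h j with p zero in p0 | j
... | true | suc _ = zero , (λ ()) , p0
... | true | zero with count-witness (λ i → p (suc i)) (≤-pred h)
...   | i , pi = suc i , (λ ()) , pi
count-other {suc n} p h j | false | zero with count-witness (λ i → p (suc i)) (≤-trans (s≤s z≤n) h)
...   | i , pi = suc i , (λ ()) , pi
count-other {suc n} p h j | false | suc j′ with count-other (λ i → p (suc i)) h j′
...   | i , i≢j′ , pi = suc i , (λ e → i≢j′ (suc-injective e)) , pi

count-split : ∀ {n} (p q : Fin n → Bool) →
              count p ≡ count (λ i → p i ∧ q i) + count (λ i → p i ∧ not (q i))
count-split {zero} p q = refl
count-split {suc n} p q with p zero | q zero | count-split (λ i → p (suc i)) (λ i → q (suc i))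
... | true  | true  | ih = cong suc ih
... | true  | false | ih = trans (cong suc ih) (sym (+-suc _ _))
... | false | _     | ih = ih

choose : ∀ {n} → (Fin n → Bool) → Fin n → Fin n
choose p default with any? (λ i → p i ≟ᴮ true)
... | yes (i , _) = i
... | no _ = default

choose-spec : ∀ {n} (p : Fin n → Bool) default {i} → p i ≡ true → p (choose p default) ≡ true
choose-spec p default {i} pi with any? (λ i → p i ≟ᴮ true)
... | yes (_ , pj) = pj
... | no none = ⊥-elim (none (i , pi))

adjacent-sym : ∀ {n} (G : Graph n) {x y} → Adjacent G x y → Adjacent G y x
adjacent-sym G {x} {y} xy = trans (adj-comm G y x) xy

nonadjacent-sym : ∀ {n} (G : Graph n) {x y} → adj G x y ≡ false → adj G y x ≡ false
nonadjacent-sym G {x} {y} xy = trans (adj-comm G y x) xy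

adjacent⇒distinct : ∀ {n} (G : Graph n) {x y} → Adjacent G x y → x ≢ y
adjacent⇒distinct G {x} xy refl with trans (sym xy) (irrefl G x)
... | ()

true≢false : true ≢ false
true≢false ()

∧-true : ∀ {a b} → a ∧ b ≡ true → a ≡ true × b ≡ true
∧-true {a} {b} ab = ∧-conicalˡ a b ab , ∧-conicalʳ a b ab

∧-intro : ∀ {a b} → a ≡ true → b ≡ true → a ∧ b ≡ true
∧-intro refl refl = refl

∧-not-true : ∀ {a b} → a ∧ not b ≡ true → a ≡ true × b ≡ false
∧-not-true {a} {b} ab = ∧-conicalˡ a (not b) ab , not-injective (∧-conicalʳ a (not b) ab)

unique-⊆ : ∀ {A : Set} {xs ys : List A} → ys ⊆ xs → Unique xs → Unique ys
unique-⊆ [] [] = []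
unique-⊆ (_ ∷ʳ ys⊆xs) (_ ∷ u) = unique-⊆ ys⊆xs u
unique-⊆ (refl ∷ ys⊆xs) (x∉ ∷ u) = All-resp-⊆ ys⊆xs x∉ ∷ unique-⊆ ys⊆xs u

unique-reverse : ∀ {k} {xs : List (Fin k)} → Unique xs → Unique (reverse xs)
unique-reverse {k} {xs} = Perm.Unique-resp-↭ (setoid (Fin k)) (↭⇒↭ₛ (↭-sym (Perm↭.↭-reverse xs)))

module RainbowWalks {n k} {G : Graph n} (c : EdgeColouring G k) where

  open import Data.List.Membership.DecPropositional (_≟_ {n}) using (_∈?_)

  route : Fin n → List (Fin n) → Fin n → List (Fin n)
  route u mid v = u ∷ (mid ++ v ∷ [])

  RainbowWalk : Fin n → Fin n → Set
  RainbowWalk u v = ∃[ mid ] (Walk G (route u mid v) × Unique (edgeColours c (route u mid v)))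

  rainbow-walk : ∀ {u v} mid → Walk G (route u mid v) → ∀ {cs} →
                 Pointwise _≡_ (edgeColours c (route u mid v)) cs → Unique cs → RainbowWalk u v
  rainbow-walk mid walk colours distinct = mid , walk , subst Unique (sym (Pointwise-≡⇒≡ colours)) distinct

  walk-drop : ∀ xs {ys} → Walk G (xs ++ ys) → Walk G ys
  walk-drop [] w = w
  walk-drop (x ∷ []) {[]} w = tt
  walk-drop (x ∷ []) {y ∷ ys} (_ , w) = w
  walk-drop (x ∷ x′ ∷ xs) (_ , w) = walk-drop (x′ ∷ xs) w

  colours-drop : ∀ xs {ys} → edgeColours c ys ⊆ edgeColours c (xs ++ ys)
  colours-drop [] = ⊆-refl
  colours-drop (x ∷ []) {[]} = []
  colours-drop (x ∷ []) {y ∷ ys} = col c x y ∷ʳ ⊆-refl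
  colours-drop (x ∷ x′ ∷ xs) = col c x x′ ∷ʳ colours-drop (x′ ∷ xs)

  unique-drop : ∀ {A : Set} xs {ys : List A} → Unique (xs ++ ys) → Unique ys
  unique-drop [] u = u
  unique-drop (x ∷ xs) (_ ∷ u) = unique-drop xs u

  PathWithin : Fin n → Fin n → List (Fin k) → Set
  PathWithin u v budget = ∃[ mid ] (Unique (route u mid v) × Walk G (route u mid v)
                                     × edgeColours c (route u mid v) ⊆ budget)

  shortcut : ∀ u mid v → u ≢ v → Walk G (route u mid v) →
             PathWithin u v (edgeColours c (route u mid v))
  shortcut u [] v u≢v w = [] , (u≢v ∷ []) ∷ [] ∷ [] , w , ⊆-refl
  shortcut u (y ∷ mid) v u≢v (uy , w) with y ≟ v
  ... | yes refl = [] , (u≢v ∷ []) ∷ [] ∷ [] , (uy , tt) , (refl ∷ minimum _)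
  ... | no y≢v with shortcut y mid v y≢v w
  ... | mid′ , uniq , walk , sub with u ∈? mid′
  ... | no u∉mid′ = y ∷ mid′ , (u∉route ∷ uniq) , (uy , walk) , (refl ∷ sub)
    where u∉route = adjacent⇒distinct G uy ∷ All-++⁺ (¬Any⇒All¬ mid′ u∉mid′) (u≢v ∷ [])
  ... | yes u∈mid′ with ∈-∃++ u∈mid′
  ... | pre , post , refl =
        post , unique-drop (y ∷ pre) (subst Unique split uniq)
             , walk-drop (y ∷ pre) (subst (Walk G) split walk)
             , col c u y ∷ʳ ⊆-trans (colours-drop (y ∷ pre)) (subst (λ ps → edgeColours c ps ⊆ budget) split sub)
    where budget = edgeColours c (route y mid v)
          split : route y (pre ++ u ∷ post) v ≡ (y ∷ pre) ++ route u post v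
          split = cong (y ∷_) (++-assoc pre (u ∷ post) (v ∷ []))

  rainbowWalk⇒path : ∀ {u v} → u ≢ v → RainbowWalk u v → RainbowPath c u v
  rainbowWalk⇒path {u} {v} u≢v (mid , walk , rainbow)
    with shortcut u mid v u≢v walk
  ... | mid′ , uniq , walk′ , sub = mid′ , uniq , walk′ , unique-⊆ sub rainbow

  walk-reverseAcc : ∀ x acc xs → Walk G (x ∷ acc) → Walk G (x ∷ xs) →
                    Walk G (reverseAcc (x ∷ acc) xs)
  walk-reverseAcc x acc [] wacc _ = wacc
  walk-reverseAcc x acc (y ∷ ys) wacc (xy , wys) =
    walk-reverseAcc y (x ∷ acc) ys (adjacent-sym G xy , wacc) wys

  colours-reverseAcc : ∀ x acc xs →
    edgeColours c (reverseAcc (x ∷ acc) xs)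
      ≡ reverseAcc (edgeColours c (x ∷ acc)) (edgeColours c (x ∷ xs))
  colours-reverseAcc x acc [] = refl
  colours-reverseAcc x acc (y ∷ ys) =
    trans (colours-reverseAcc y (x ∷ acc) ys)
          (cong (λ z → reverseAcc (z ∷ edgeColours c (x ∷ acc)) (edgeColours c (y ∷ ys)))
                (colSym c y x))

  reverse-route : ∀ u mid v → reverse (route u mid v) ≡ route v (reverse mid) u
  reverse-route u mid v = begin
    reverse (route u mid v)             ≡⟨ unfold-reverse u (mid ++ v ∷ []) ⟩
    reverse (mid ++ v ∷ []) ++ u ∷ []   ≡⟨ cong (_++ u ∷ []) (reverse-++ mid (v ∷ [])) ⟩
    route v (reverse mid) u             ∎
    where open ≡-Reasoning

  -- Colours are symmetric, so a rainbow walk read backwards is rainbow.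
  rainbowWalk-sym : ∀ {u v} → RainbowWalk u v → RainbowWalk v u
  rainbowWalk-sym {u} {v} (mid , walk , rainbow) =
    reverse mid
    , subst (Walk G) (reverse-route u mid v) (walk-reverseAcc u [] (mid ++ v ∷ []) tt walk)
    , subst (λ ps → Unique (edgeColours c ps)) (reverse-route u mid v)
        (subst Unique (sym (colours-reverseAcc u [] (mid ++ v ∷ []))) (unique-reverse rainbow))

-- Ore's theorem, in the form needed here: if every vertex of a set U has a
-- neighbour in U, then U can be 2-coloured so that every vertex of U has a
-- neighbour in U of the other colour.  The colouring is (the indicator of) a
-- minimal dominating set of G[U].
module Ore {n} (G : Graph n) (U : Fin n → Bool) where

  Subset : Set
  Subset = Fin n → Bool

  DominatedIn : Subset → Fin n → Set
  DominatedIn D u = D u ≡ true ⊎ ∃[ d ] (D d ≡ true × Adjacent G u d)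

  dominatedIn? : ∀ D u → Dec (DominatedIn D u)
  dominatedIn? D u = (D u ≟ᴮ true) ⊎-dec any? (λ d → (D d ≟ᴮ true) ×-dec (adj G u d ≟ᴮ true))

  Dominating : Subset → Set
  Dominating D = ∀ u → U u ≡ true → DominatedIn D u

  dominating? : ∀ D → Dec (Dominating D)
  dominating? D = all? λ u → (U u ≟ᴮ true) →-dec dominatedIn? D u

  undominated : ∀ D → ¬ Dominating D → ∃[ w ] (U w ≡ true × ¬ DominatedIn D w)
  undominated D ¬dom with ¬∀⟶∃¬ n _ (λ u → (U u ≟ᴮ true) →-dec dominatedIn? D u) ¬dom
  ... | w , ¬dominated with U w in Uw
  ...   | true = w , Uw , λ dw → ¬dominated (λ _ → dw)
  ...   | false = ⊥-elim (¬dominated (λ ()))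

  remove : Subset → Fin n → Subset
  remove D a j = D j ∧ not (does (j ≟ a))

  remove-keeps : ∀ D {a j} → D j ≡ true → j ≢ a → remove D a j ≡ true
  remove-keeps D {a} {j} Dj j≢a rewrite Dj | dec-false (j ≟ a) j≢a = refl

  remove-shrinks : ∀ D {a} → D a ≡ true → count (remove D a) < count D
  remove-shrinks D {a} Da =
    subst (suc (count (remove D a)) ≤_) (sym (count-split D (λ j → does (j ≟ a))))
          (+-monoˡ-≤ (count (remove D a)) (witness-count (λ j → D j ∧ does (j ≟ a)) a-counted))
    where
      -- D splits into {a} and remove D a, and a is counted in the first part
      a-counted : D a ∧ does (a ≟ a) ≡ true
      a-counted = ∧-intro Da (dec-true (a ≟ a) refl)

  Minimal : Subset → Set
  Minimal D = ∀ a → D a ≡ true → ¬ Dominating (remove D a)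

  Within : Subset → Set
  Within D = ∀ a → D a ≡ true → U a ≡ true

  minimise : ∀ fuel D → count D ≤ fuel → Within D → Dominating D →
             ∃[ D′ ] (Within D′ × Dominating D′ × Minimal D′)
  minimise fuel D bound within dom with any? (λ a → (D a ≟ᴮ true) ×-dec dominating? (remove D a))
  ... | no stuck = D , within , dom , λ a Da dom′ → stuck (a , Da , dom′)
  minimise zero D bound within dom | yes (a , Da , _) with ≤-trans (remove-shrinks D Da) bound
  ... | ()
  minimise (suc fuel) D bound within dom | yes (a , Da , dom′) =
    minimise fuel (remove D a) (≤-pred (≤-trans (remove-shrinks D Da) bound))
             (λ j r → within j (∧-conicalˡ _ _ r)) dom′

  NoIsolated : Set
  NoIsolated = ∀ a → U a ≡ true → ∃[ b ] (U b ≡ true × Adjacent G a b)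

  -- In a minimal dominating set D each vertex of D has a U-neighbour outside
  -- D; otherwise removing it would leave a dominating set.
  outside-neighbour : ∀ D → Within D → Dominating D → Minimal D → NoIsolated →
    ∀ a → D a ≡ true → ∃[ b ] (U b ≡ true × Adjacent G a b × D b ≡ false)
  outside-neighbour D within dom minimal noIsolated a Da
    with undominated (remove D a) (minimal a Da)
  ... | w , Uw , ¬dominated = neighbour-of (w ≟ a)
    where
      neighbour-of : Dec (w ≡ a) → ∃[ b ] (U b ≡ true × Adjacent G a b × D b ≡ false)
      -- a itself is undominated: its U-neighbours all lie outside D
      neighbour-of (yes refl) with noIsolated a Uw
      ... | b , Ub , ab with D b ≟ᴮ true
      ...   | yes Db = ⊥-elim (¬dominated (inj₂ (b , remove-keeps D Db (≢-sym (adjacent⇒distinct G ab)) , ab)))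
      ...   | no ¬Db = b , Ub , ab , ¬-not ¬Db
      -- w ≠ a is undominated: w ∉ D, and its only D-neighbour is a
      neighbour-of (no w≢a) with D w ≟ᴮ true
      ... | yes Dw = ⊥-elim (¬dominated (inj₁ (remove-keeps D Dw w≢a)))
      ... | no ¬Dw with dom w Uw
      ...   | inj₁ Dw = ⊥-elim (¬Dw Dw)
      ...   | inj₂ (d , Dd , wd) with d ≟ a
      ...     | yes refl = w , Uw , adjacent-sym G wd , ¬-not ¬Dw
      ...     | no d≢a = ⊥-elim (¬dominated (inj₂ (d , remove-keeps D Dd d≢a , wd)))

  ore : NoIsolated → ∃[ side ] ∀ a → U a ≡ true → ∃[ b ] (U b ≡ true × Adjacent G a b × side a ≢ side b)
  ore noIsolated with minimise (count U) U ≤-refl (λ _ Ua → Ua) (λ _ Uu → inj₁ Uu)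
  ... | D , within , dom , minimal = D , other-side
    where
      other-side : ∀ a → U a ≡ true → ∃[ b ] (U b ≡ true × Adjacent G a b × D a ≢ D b)
      other-side a Ua with D a ≟ᴮ true
      ... | yes Da with outside-neighbour D within dom minimal noIsolated a Da
      ...   | b , Ub , ab , Db = b , Ub , ab , λ e → true≢false (trans (trans (sym Da) e) Db)
      other-side a Ua | no ¬Da with dom a Ua
      ...   | inj₁ Da = ⊥-elim (¬Da Da)
      ...   | inj₂ (d , Dd , ad) = d , within d Dd , ad , λ e → ¬Da (trans e Dd)

-- The five colours: two for the spokes at the centre, two for the edges
-- between the two neighbourhoods, and one for all remaining edges.
spoke tint : Bool → Fin 5
spoke true = zero
spoke false = suc zero
tint true = suc (suc zero)
tint false = suc (suc (suc zero))

plain : Fin 5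
plain = suc (suc (suc (suc zero)))

-- A list of colours depending on one Boolean parameter is repetition-free
-- for every parameter value as soon as it is for both values (checked by
-- computation).
distinct : (cs : Bool → List (Fin 5)) → {True (unique? (cs true))} → {True (unique? (cs false))} →
           ∀ β → Unique (cs β)
distinct cs {t} true = toWitness t
distinct cs {_} {f} false = toWitness f

module Neighbourhoods {n} (G : Graph n) (v : Fin n) where

  Inner : Fin n → Set
  Inner a = Adjacent G v a

  Outer : Fin n → Set
  Outer x = adj G v x ≡ false × x ≢ v

  data Position (u : Fin n) : Set where
    centre : u ≡ v → Position u
    inner  : Inner u → Position u
    outer  : Outer u → Position u

  position : ∀ u → Position u
  position u with u ≟ v | adj G v u in vu
  ... | yes u≡v | _     = centre u≡v
  ... | no _    | true  = inner vu
  ... | no u≢v  | false = outer (vu , u≢v)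

  data Place : Set where
    centre inner outer : Place

  place : Fin n → Place
  place u with position u
  ... | centre _ = centre
  ... | inner _  = inner
  ... | outer _  = outer

  place-centre : place v ≡ centre
  place-centre with position v
  ... | centre _ = refl
  ... | inner vv = ⊥-elim (adjacent⇒distinct G vv refl)
  ... | outer (_ , v≢v) = ⊥-elim (v≢v refl)

  place-inner : ∀ {a} → Inner a → place a ≡ inner
  place-inner {a} ia with position a
  ... | centre refl = ⊥-elim (adjacent⇒distinct G ia refl)
  ... | inner _ = refl
  ... | outer (na , _) = ⊥-elim (true≢false (trans (sym ia) na))

  place-outer : ∀ {x} → Outer x → place x ≡ outer
  place-outer {x} (nx , x≢v) with position x
  ... | centre x≡v = ⊥-elim (x≢v x≡v)
  ... | inner ix = ⊥-elim (true≢false (trans (sym ix) nx))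
  ... | outer _ = refl

  module Painting (side : Fin n → Bool) (cross : Fin n → Fin n → Bool) where

    paint : Place → Place → Fin n → Fin n → Fin 5
    paint centre inner _ a = spoke (side a)
    paint inner centre a _ = spoke (side a)
    paint outer inner x a = tint (cross x a)
    paint inner outer a x = tint (cross x a)
    paint _ _ _ _ = plain

    paint-sym : ∀ p q u w → paint p q u w ≡ paint q p w u
    paint-sym centre centre _ _ = refl
    paint-sym centre inner  _ _ = refl
    paint-sym centre outer  _ _ = refl
    paint-sym inner  centre _ _ = refl
    paint-sym inner  inner  _ _ = refl
    paint-sym inner  outer  _ _ = refl
    paint-sym outer  centre _ _ = refl
    paint-sym outer  inner  _ _ = refl
    paint-sym outer  outer  _ _ = refl

    colouring : EdgeColouring G 5
    colouring = record
      { col    = λ u w → paint (place u) (place w) u w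
      ; colSym = λ u w → paint-sym (place u) (place w) u w }

    spoke-from : ∀ {a β} → Inner a → side a ≡ β → col colouring v a ≡ spoke β
    spoke-from {a} ia refl rewrite place-centre | place-inner ia = refl

    spoke-to : ∀ {a β} → Inner a → side a ≡ β → col colouring a v ≡ spoke β
    spoke-to {a} ia refl rewrite place-centre | place-inner ia = refl

    cross-out : ∀ {x a β} → Outer x → Inner a → cross x a ≡ β → col colouring x a ≡ tint β
    cross-out ox ia refl rewrite place-outer ox | place-inner ia = refl

    cross-in : ∀ {a x β} → Inner a → Outer x → cross x a ≡ β → col colouring a x ≡ tint β
    cross-in ia ox refl rewrite place-outer ox | place-inner ia = refl

    plain-inner : ∀ {a b} → Inner a → Inner b → col colouring a b ≡ plain
    plain-inner ia ib rewrite place-inner ia | place-inner ib = refl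

    plain-outer : ∀ {x y} → Outer x → Outer y → col colouring x y ≡ plain
    plain-outer ox oy rewrite place-outer ox | place-outer oy = refl

  module _ {k} (c : EdgeColouring G k) where
    open RainbowWalks c

    single-edge : ∀ {u w} → Adjacent G u w → RainbowWalk u w
    single-edge uw = [] , (uw , tt) , [] ∷ []

    record Connections : Set where
      field
        outer-centre : ∀ {x} → Outer x → RainbowWalk x v
        inner-inner  : ∀ {a b} → Inner a → Inner b → RainbowWalk a b
        outer-inner  : ∀ {x a} → Outer x → Inner a → RainbowWalk x a
        outer-outer  : ∀ {x y} → Outer x → Outer y → RainbowWalk x y

    connections⇒rainbow : Connections → RainbowConnecting c
    connections⇒rainbow conn u w u≢w = rainbowWalk⇒path u≢w (walk (position u) (position w))
      where
        open Connections conn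
        walk : Position u → Position w → RainbowWalk u w
        walk (centre refl) (centre refl) = ⊥-elim (u≢w refl)
        walk (centre refl) (inner iw)    = single-edge iw
        walk (centre refl) (outer ow)    = rainbowWalk-sym (outer-centre ow)
        walk (inner iu)    (centre refl) = single-edge (adjacent-sym G iu)
        walk (inner iu)    (inner iw)    = inner-inner iu iw
        walk (inner iu)    (outer ow)    = rainbowWalk-sym (outer-inner ow iu)
        walk (outer ou)    (centre refl) = outer-centre ou
        walk (outer ou)    (inner iw)    = outer-inner ou iw
        walk (outer ou)    (outer ow)    = outer-outer ou ow

module SideTinted {n} (G : Graph n) (v : Fin n) (side : Fin n → Bool) where
  open Neighbourhoods G v
  open Painting side (λ _ a → side a)
  open RainbowWalks colouring

  Reaches : Bool → Fin n → Set
  Reaches β x = ∃[ a ] (Inner a × side a ≡ β × Adjacent G x a)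
              ⊎ ∃[ y ] (Outer y × Adjacent G x y × ∃[ a ] (Inner a × side a ≡ β × Adjacent G y a))

  module _ (outer-neighbour : ∀ {a} → Inner a → ∃[ x ] (Outer x × Adjacent G a x))
           (inner-neighbour : ∀ {x} → Outer x → ∃[ a ] (Inner a × Adjacent G x a))
           (reaches : ∀ β {x} → Outer x → Reaches β x) where

    outer-centre : ∀ {x} → Outer x → RainbowWalk x v
    outer-centre ox with inner-neighbour ox
    ... | a , ia , xa = rainbow-walk (a ∷ []) (xa , adjacent-sym G ia , tt)
          (cross-out ox ia refl ∷ spoke-to ia refl ∷ [])
          (distinct (λ β → tint β ∷ spoke β ∷ []) (side a))

    -- a v b across the sides; within a side, leave a to an outer x and
    -- from there reach the other side
    inner-inner : ∀ {a b} → Inner a → Inner b → RainbowWalk a b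
    inner-inner {a} {b} ia ib with side a ≟ᴮ side b
    ... | no differ = rainbow-walk (v ∷ []) (adjacent-sym G ia , ib , tt)
          (spoke-to ia (¬-not differ) ∷ spoke-from ib refl ∷ [])
          (distinct (λ β → spoke (not β) ∷ spoke β ∷ []) (side b))
    ... | yes same with outer-neighbour ia
    ...   | x , ox , ax with reaches (not (side b)) ox
    ...     | inj₁ (b′ , ib′ , sb′ , xb′) =
            rainbow-walk (x ∷ b′ ∷ v ∷ []) (ax , xb′ , adjacent-sym G ib′ , ib , tt)
              (cross-in ia ox same ∷ cross-out ox ib′ sb′ ∷ spoke-to ib′ sb′ ∷ spoke-from ib refl ∷ [])
              (distinct (λ β → tint β ∷ tint (not β) ∷ spoke (not β) ∷ spoke β ∷ []) (side b))
    ...     | inj₂ (y , oy , xy , b′ , ib′ , sb′ , yb′) =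
            rainbow-walk (x ∷ y ∷ b′ ∷ v ∷ []) (ax , xy , yb′ , adjacent-sym G ib′ , ib , tt)
              (cross-in ia ox same ∷ plain-outer ox oy ∷ cross-out oy ib′ sb′ ∷ spoke-to ib′ sb′
                 ∷ spoke-from ib refl ∷ [])
              (distinct (λ β → tint β ∷ plain ∷ tint (not β) ∷ spoke (not β) ∷ spoke β ∷ []) (side b))

    -- from x reach the side opposite to a, then go through v
    outer-inner : ∀ {x a} → Outer x → Inner a → RainbowWalk x a
    outer-inner {x} {a} ox ia with reaches (not (side a)) ox
    ... | inj₁ (b′ , ib′ , sb′ , xb′) =
          rainbow-walk (b′ ∷ v ∷ []) (xb′ , adjacent-sym G ib′ , ia , tt)
            (cross-out ox ib′ sb′ ∷ spoke-to ib′ sb′ ∷ spoke-from ia refl ∷ [])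
            (distinct (λ β → tint (not β) ∷ spoke (not β) ∷ spoke β ∷ []) (side a))
    ... | inj₂ (y , oy , xy , b′ , ib′ , sb′ , yb′) =
          rainbow-walk (y ∷ b′ ∷ v ∷ []) (xy , yb′ , adjacent-sym G ib′ , ia , tt)
            (plain-outer ox oy ∷ cross-out oy ib′ sb′ ∷ spoke-to ib′ sb′ ∷ spoke-from ia refl ∷ [])
            (distinct (λ β → plain ∷ tint (not β) ∷ spoke (not β) ∷ spoke β ∷ []) (side a))

    -- x a v, then backwards along the way from y to the side opposite to a
    outer-outer : ∀ {x y} → Outer x → Outer y → RainbowWalk x y
    outer-outer {x} {y} ox oy with inner-neighbour ox
    ... | a , ia , xa with reaches (not (side a)) oy
    ...   | inj₁ (b′ , ib′ , sb′ , yb′) =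
            rainbow-walk (a ∷ v ∷ b′ ∷ []) (xa , adjacent-sym G ia , ib′ , adjacent-sym G yb′ , tt)
              (cross-out ox ia refl ∷ spoke-to ia refl ∷ spoke-from ib′ sb′ ∷ cross-in ib′ oy sb′ ∷ [])
              (distinct (λ β → tint β ∷ spoke β ∷ spoke (not β) ∷ tint (not β) ∷ []) (side a))
    ...   | inj₂ (y′ , oy′ , yy′ , b′ , ib′ , sb′ , y′b′) =
            rainbow-walk (a ∷ v ∷ b′ ∷ y′ ∷ [])
              (xa , adjacent-sym G ia , ib′ , adjacent-sym G y′b′ , adjacent-sym G yy′ , tt)
              (cross-out ox ia refl ∷ spoke-to ia refl ∷ spoke-from ib′ sb′ ∷ cross-in ib′ oy′ sb′
                 ∷ plain-outer oy′ oy ∷ [])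
              (distinct (λ β → tint β ∷ spoke β ∷ spoke (not β) ∷ tint (not β) ∷ plain ∷ []) (side a))

    rainbow : RainbowConnecting colouring
    rainbow = connections⇒rainbow colouring record
      { outer-centre = outer-centre ; inner-inner = inner-inner
      ; outer-inner = outer-inner ; outer-outer = outer-outer }

-- Second scheme: every outer x has a distinguished inner neighbour first x;
-- the edge x–first x gets the tint true and the other x–a edges tint false.
module FirstTinted {n} (G : Graph n) (v : Fin n) (side : Fin n → Bool) (first : Fin n → Fin n) where
  open Neighbourhoods G v
  open Painting side (λ x a → does (a ≟ first x))
  open RainbowWalks colouring

  module _ (other-side : ∀ {a} → Inner a → ∃[ b ] (Inner b × Adjacent G a b × side a ≢ side b))
           (first-neighbour : ∀ {x} → Outer x → Inner (first x) × Adjacent G x (first x))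
           (second-neighbour : ∀ {x} → Outer x → ∃[ q ] (Inner q × Adjacent G x q × q ≢ first x)) where

    first-tint : ∀ {x} → does (first x ≟ first x) ≡ true
    first-tint {x} = dec-true (first x ≟ first x) refl

    flipped : ∀ {p b c} → side p ≡ side b → side p ≢ side c → side c ≡ not (side b)
    flipped same differ = ¬-not (λ e → differ (trans same (sym e)))

    outer-centre : ∀ {x} → Outer x → RainbowWalk x v
    outer-centre {x} ox with first-neighbour ox
    ... | ip , xp = rainbow-walk (first x ∷ []) (xp , adjacent-sym G ip , tt)
          (cross-out ox ip first-tint ∷ spoke-to ip refl ∷ [])
          (distinct (λ β → tint true ∷ spoke β ∷ []) (side (first x)))

    -- a v b across the sides, a c v b with c on the other side otherwise
    inner-inner : ∀ {a b} → Inner a → Inner b → RainbowWalk a b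
    inner-inner {a} {b} ia ib with side a ≟ᴮ side b
    ... | no differ = rainbow-walk (v ∷ []) (adjacent-sym G ia , ib , tt)
          (spoke-to ia (¬-not differ) ∷ spoke-from ib refl ∷ [])
          (distinct (λ β → spoke (not β) ∷ spoke β ∷ []) (side b))
    ... | yes same with other-side ia
    ...   | c , ic , ac , differ = rainbow-walk (c ∷ v ∷ []) (ac , adjacent-sym G ic , ib , tt)
            (plain-inner ia ic ∷ spoke-to ic (flipped same differ) ∷ spoke-from ib refl ∷ [])
            (distinct (λ β → plain ∷ spoke (not β) ∷ spoke β ∷ []) (side b))

    -- x p v a, or x p c v a with c a neighbour of p = first x on the other side
    outer-inner : ∀ {x a} → Outer x → Inner a → RainbowWalk x a
    outer-inner {x} {a} ox ia with first-neighbour ox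
    ... | ip , xp with side (first x) ≟ᴮ side a
    ...   | no differ = rainbow-walk (first x ∷ v ∷ []) (xp , adjacent-sym G ip , ia , tt)
            (cross-out ox ip first-tint ∷ spoke-to ip (¬-not differ) ∷ spoke-from ia refl ∷ [])
            (distinct (λ β → tint true ∷ spoke (not β) ∷ spoke β ∷ []) (side a))
    ...   | yes same with other-side ip
    ...     | c , ic , pc , differ = rainbow-walk (first x ∷ c ∷ v ∷ []) (xp , pc , adjacent-sym G ic , ia , tt)
              (cross-out ox ip first-tint ∷ plain-inner ip ic ∷ spoke-to ic (flipped same differ)
                 ∷ spoke-from ia refl ∷ [])
              (distinct (λ β → tint true ∷ plain ∷ spoke (not β) ∷ spoke β ∷ []) (side a))

    -- x p v q y, or x p c v q y, where p = first x and q ≠ first y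
    outer-outer : ∀ {x y} → Outer x → Outer y → RainbowWalk x y
    outer-outer {x} {y} ox oy with first-neighbour ox | second-neighbour oy
    ... | ip , xp | q , iq , yq , q≢first with side (first x) ≟ᴮ side q
    ...   | no differ = rainbow-walk (first x ∷ v ∷ q ∷ []) (xp , adjacent-sym G ip , iq , adjacent-sym G yq , tt)
            (cross-out ox ip first-tint ∷ spoke-to ip (¬-not differ) ∷ spoke-from iq refl
               ∷ cross-in iq oy (dec-false (q ≟ first y) q≢first) ∷ [])
            (distinct (λ β → tint true ∷ spoke (not β) ∷ spoke β ∷ tint false ∷ []) (side q))
    ...   | yes same with other-side ip
    ...     | c , ic , pc , differ = rainbow-walk (first x ∷ c ∷ v ∷ q ∷ [])
              (xp , pc , adjacent-sym G ic , iq , adjacent-sym G yq , tt)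
              (cross-out ox ip first-tint ∷ plain-inner ip ic ∷ spoke-to ic (flipped same differ)
                 ∷ spoke-from iq refl ∷ cross-in iq oy (dec-false (q ≟ first y) q≢first) ∷ [])
              (distinct (λ β → tint true ∷ plain ∷ spoke (not β) ∷ spoke β ∷ tint false ∷ []) (side q))

    rainbow : RainbowConnecting colouring
    rainbow = connections⇒rainbow colouring record
      { outer-centre = outer-centre ; inner-inner = inner-inner
      ; outer-inner = outer-inner ; outer-outer = outer-outer }

module StronglyRegular {n} (G : Graph n) {k l m : ℕ}
  (regular : ∀ v → degree G v ≡ k)
  (adjacent-common : ∀ u v → u ≢ v → Adjacent G u v → commonNeighbours G u v ≡ l)
  (nonadjacent-common : ∀ u v → u ≢ v → ¬ Adjacent G u v → commonNeighbours G u v ≡ m)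
  where

  nonadjacent-count : ∀ {x y} → x ≢ y → adj G x y ≡ false → commonNeighbours G x y ≡ m
  nonadjacent-count x≢y xy = nonadjacent-common _ _ x≢y (λ e → true≢false (trans (sym e) xy))

  common-neighbour : m ≥ 1 → ∀ {x y} → x ≢ y → adj G x y ≡ false →
                     ∃[ w ] (Adjacent G x w × Adjacent G y w)
  common-neighbour m≥1 x≢y xy with count-witness _ (subst (1 ≤_) (sym (nonadjacent-count x≢y xy)) m≥1)
  ... | w , xwyw = w , ∧-true xwyw

  no-triangle : l ≡ 0 → ∀ {a b c} → Adjacent G a b → Adjacent G a c → Adjacent G b c → ⊥
  no-triangle l≡0 {a} {b} ab ac bc
    with subst (1 ≤_) (trans (adjacent-common a b (adjacent⇒distinct G ab) ab) l≡0)
               (witness-count (λ w → adj G a w ∧ adj G b w) (∧-intro ac bc))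
  ... | ()

  unique-common : m ≡ 1 → ∀ {x y a b} → x ≢ y → adj G x y ≡ false →
                  Adjacent G x a → Adjacent G y a → Adjacent G x b → Adjacent G y b → a ≡ b
  unique-common m≡1 {x} {y} {a} {b} x≢y xy xa ya xb yb with a ≟ b
  ... | yes a≡b = a≡b
  ... | no a≢b with subst (2 ≤_) (trans (nonadjacent-count x≢y xy) m≡1)
                     (witnesses-count (λ w → adj G x w ∧ adj G y w) a≢b (∧-intro xa ya) (∧-intro xb yb))
  ...   | s≤s ()

  exclusive : Fin n → Fin n → ℕ
  exclusive a b = count (λ w → adj G a w ∧ not (adj G b w))

  degree-split : ∀ {a b} → Adjacent G a b → k ≡ l + exclusive a b
  degree-split {a} {b} ab = begin
    k                                       ≡⟨ sym (regular a) ⟩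
    degree G a                              ≡⟨ count-split (adj G a) (adj G b) ⟩
    commonNeighbours G a b + exclusive a b  ≡⟨ cong (_+ exclusive a b) λ-common ⟩
    l + exclusive a b                       ∎
    where
      open ≡-Reasoning
      λ-common : commonNeighbours G a b ≡ l
      λ-common = adjacent-common a b (adjacent⇒distinct G ab) ab

  module AroundNonEdge (m≥1 : m ≥ 1) {v u0 : Fin n} (v≢u0 : v ≢ u0) (vu0 : adj G v u0 ≡ false) where
    open Neighbourhoods G v

    u0-v-common : ∃[ c ] (Adjacent G u0 c × Inner c)
    u0-v-common = common-neighbour m≥1 (≢-sym v≢u0) (nonadjacent-sym G vu0)

    c0 : Fin n
    c0 = proj₁ u0-v-common

    u0c0 : Adjacent G u0 c0
    u0c0 = proj₁ (proj₂ u0-v-common)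

    inner-c0 : Inner c0
    inner-c0 = proj₂ (proj₂ u0-v-common)

    -- k − λ ≥ 2: the edge c0 v has v and u0 as exclusive neighbours of c0,
    -- and the number of exclusive neighbours is k − λ for every edge.
    two-exclusive : ∀ {a b} → Adjacent G a b → 2 ≤ exclusive a b
    two-exclusive ab = subst (2 ≤_) (+-cancelˡ-≡ l _ _ (trans (sym (degree-split c0v)) (degree-split ab)))
                        (witnesses-count _ v≢u0 v-exclusive u0-exclusive)
      where
        c0v = adjacent-sym G inner-c0
        v-exclusive : adj G c0 v ∧ not (adj G v v) ≡ true
        v-exclusive rewrite c0v | irrefl G v = refl
        u0-exclusive : adj G c0 u0 ∧ not (adj G v u0) ≡ true
        u0-exclusive rewrite adjacent-sym G u0c0 | vu0 = refl

    inner-neighbour : ∀ {x} → Outer x → ∃[ a ] (Inner a × Adjacent G x a)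
    inner-neighbour (vx , x≢v) with common-neighbour m≥1 x≢v (nonadjacent-sym G vx)
    ... | a , xa , va = a , va , xa

    outer-neighbour : ∀ {a} → Inner a → ∃[ x ] (Outer x × Adjacent G a x)
    outer-neighbour {a} ia with count-other _ (two-exclusive (adjacent-sym G ia)) v
    ... | x , x≢v , exclusive-x with ∧-not-true exclusive-x
    ...   | ax , vx = x , (vx , x≢v) , ax

    inner-non-neighbour : ∀ {a} → Inner a → ∃[ b ] (Inner b × b ≢ a × adj G a b ≡ false)
    inner-non-neighbour {a} ia with count-other _ (two-exclusive ia) a
    ... | b , b≢a , exclusive-b with ∧-not-true exclusive-b
    ...   | vb , ab = b , vb , b≢a , ab

    outer≢inner : ∀ {x a} → Outer x → Inner a → x ≢ a
    outer≢inner (vx , _) ia refl = true≢false (trans (sym ia) vx)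

    beside-outer : ∀ {x y} → Outer x → Adjacent G x y → y ≢ v
    beside-outer (vx , _) xy refl = true≢false (trans (sym (adjacent-sym G xy)) vx)

    -- Case λ = 0.  Sides: c0 versus the other inner vertices.  Since G has
    -- no triangles, the common neighbour of an outer x and an inner s is
    -- outer, so x reaches every inner vertex.
    module TriangleFree (l≡0 : l ≡ 0) where
      side : Fin n → Bool
      side a = does (a ≟ c0)

      open SideTinted G v side using (Reaches; rainbow)

      reaches-via : ∀ {β s} → Inner s → side s ≡ β → ∀ {x} → Outer x → Reaches β x
      reaches-via {s = s} is ss {x} ox with adj G x s in xs
      ... | true = inj₁ (s , is , ss , xs)
      ... | false with common-neighbour m≥1 (outer≢inner ox is) xs
      ...   | y , xy , sy = inj₂ (y , (vy , beside-outer ox xy) , xy , s , is , ss , adjacent-sym G sy)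
        where
          vy : adj G v y ≡ false
          vy with adj G v y in v-y
          ... | true = ⊥-elim (no-triangle l≡0 is v-y sy)
          ... | false = refl

      reaches : ∀ β {x} → Outer x → Reaches β x
      reaches true = reaches-via inner-c0 (dec-true (c0 ≟ c0) refl)
      reaches false with inner-non-neighbour inner-c0
      ... | b , ib , b≢c0 , _ = reaches-via ib (dec-false (b ≟ c0) b≢c0)

      colouring : Σ (EdgeColouring G 5) RainbowConnecting
      colouring = _ , rainbow outer-neighbour inner-neighbour reaches

    -- Case μ = 1.  Side true is the closed neighbourhood of c0; side false
    -- contains the inner non-neighbour b of c0.
    module UniqueCommon (m≡1 : m ≡ 1) where
      side : Fin n → Bool
      side a = does (a ≟ c0) ∨ adj G c0 a

      open SideTinted G v side using (Reaches; rainbow)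

      far : ∃[ b ] (Inner b × b ≢ c0 × adj G c0 b ≡ false)
      far = inner-non-neighbour inner-c0

      b : Fin n
      b = proj₁ far

      inner-b : Inner b
      inner-b = proj₁ (proj₂ far)

      b≢c0 : b ≢ c0
      b≢c0 = proj₁ (proj₂ (proj₂ far))

      c0b : adj G c0 b ≡ false
      c0b = proj₂ (proj₂ (proj₂ far))

      side-c0 : side c0 ≡ true
      side-c0 rewrite dec-true (c0 ≟ c0) refl = refl

      side-neighbour : ∀ {a} → Adjacent G c0 a → side a ≡ true
      side-neighbour {a} c0a rewrite c0a = ∨-zeroʳ _

      side-b : side b ≡ false
      side-b rewrite dec-false (b ≟ c0) b≢c0 = c0b

      -- An inner vertex c of side true is not adjacent to b: otherwise the
      -- non-adjacent pair c0, b would have the two common neighbours v and c.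
      misses-b : ∀ {c} → Inner c → side c ≡ true → adj G c b ≡ false
      misses-b {c} ic sc with c ≟ c0
      ... | yes refl = c0b
      ... | no _ with adj G c b in cb
      ...   | false = refl
      ...   | true = ⊥-elim (adjacent⇒distinct G ic (unique-common m≡1 (≢-sym b≢c0) c0b
                                 (adjacent-sym G inner-c0) (adjacent-sym G inner-b) sc (adjacent-sym G cb)))

      -- x reaches c0, or a common neighbour of x and c0, which has side true
      -- if inner and otherwise leads to c0
      reaches-true : ∀ {x} → Outer x → Reaches true x
      reaches-true {x} ox with adj G x c0 in xc0
      ... | true = inj₁ (c0 , inner-c0 , side-c0 , xc0)
      ... | false with common-neighbour m≥1 (outer≢inner ox inner-c0) xc0
      ...   | w , xw , c0w with adj G v w in vw
      ...     | true = inj₁ (w , vw , side-neighbour c0w , xw)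
      ...     | false = inj₂ (w , (vw , beside-outer ox xw) , xw , c0 , inner-c0 , side-c0 , adjacent-sym G c0w)

      -- If the inner neighbour c of x has side true, x reaches b: a common
      -- neighbour w of x and b cannot be inner, as w and c would then be two
      -- common neighbours of the non-adjacent pair x, v.
      reaches-false : ∀ {x} → Outer x → Reaches false x
      reaches-false {x} ox with inner-neighbour ox
      ... | c , ic , xc with side c in sc
      ...   | false = inj₁ (c , ic , sc , xc)
      ...   | true with adj G x b in xb
      ...     | true = inj₁ (b , inner-b , side-b , xb)
      ...     | false with common-neighbour m≥1 (outer≢inner ox inner-b) xb
      ...       | w , xw , bw with adj G v w in vw
      ...         | false = inj₂ (w , (vw , beside-outer ox xw) , xw , b , inner-b , side-b , adjacent-sym G bw)
      ...         | true with unique-common m≡1 (proj₂ ox) (nonadjacent-sym G (proj₁ ox)) xw vw xc ic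
      ...           | refl = ⊥-elim (true≢false (trans (sym (adjacent-sym G bw)) (misses-b ic sc)))

      reaches : ∀ β {x} → Outer x → Reaches β x
      reaches true = reaches-true
      reaches false = reaches-false

      colouring : Σ (EdgeColouring G 5) RainbowConnecting
      colouring = _ , rainbow outer-neighbour inner-neighbour reaches

    -- Case λ ≥ 1, μ ≥ 2.  By λ ≥ 1 every inner vertex has an inner
    -- neighbour, so Ore's lemma splits N(v) such that each inner vertex has
    -- an inner neighbour on the other side.  By μ ≥ 2 every outer vertex has
    -- two inner neighbours, the first of which is fixed by a choice function.
    module TwoCommon (l≥1 : l ≥ 1) (m≥2 : m ≥ 2) where
      -- a common neighbour of a and v is an inner neighbour of a
      no-isolated : Ore.NoIsolated G (adj G v)
      no-isolated a ia
        with count-witness _ (subst (1 ≤_) (sym (adjacent-common a v (≢-sym (adjacent⇒distinct G ia))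
                                                                   (adjacent-sym G ia))) l≥1)
      ... | w , aw-vw = w , proj₂ (∧-true aw-vw) , proj₁ (∧-true aw-vw)

      split : ∃[ side ] ∀ a → Inner a → ∃[ b ] (Inner b × Adjacent G a b × side a ≢ side b)
      split = Ore.ore G (adj G v) no-isolated

      InnerOf : Fin n → Fin n → Bool
      InnerOf x w = adj G x w ∧ adj G v w

      first : Fin n → Fin n
      first x = choose (InnerOf x) x

      two-inner : ∀ {x} → Outer x → 2 ≤ count (InnerOf x)
      two-inner (vx , x≢v) = subst (2 ≤_) (sym (nonadjacent-count x≢v (nonadjacent-sym G vx))) m≥2

      first-neighbour : ∀ {x} → Outer x → Inner (first x) × Adjacent G x (first x)
      first-neighbour {x} ox with count-witness (InnerOf x) (≤-trans (s≤s z≤n) (two-inner ox))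
      ... | w , xw-vw with ∧-true (choose-spec (InnerOf x) x xw-vw)
      ...   | xf , vf = vf , xf

      second-neighbour : ∀ {x} → Outer x → ∃[ q ] (Inner q × Adjacent G x q × q ≢ first x)
      second-neighbour {x} ox with count-other (InnerOf x) (two-inner ox) (first x)
      ... | q , q≢first , xq-vq with ∧-true xq-vq
      ...   | xq , vq = q , vq , xq , q≢first

      colouring : Σ (EdgeColouring G 5) RainbowConnecting
      colouring = _ , FirstTinted.rainbow G v (proj₁ split) first
                        (λ {a} → proj₂ split a) first-neighbour second-neighbour

edge? : ∀ {n} (G : Graph n) u w → Dec (u ≢ w → Adjacent G u w)
edge? G u w = ¬? (u ≟ w) →-dec (adj G u w ≟ᴮ true)

non-edge : ∀ {n} (G : Graph n) → ¬ IsComplete G → ∃[ u ] ∃[ w ] (u ≢ w × adj G u w ≡ false)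
non-edge {n} G notComplete
  with ¬∀⟶∃¬ n _ (λ u → all? (edge? G u)) (λ complete → notComplete (λ u w → complete u w))
... | u , ¬complete-at-u with ¬∀⟶∃¬ n _ (edge? G u) ¬complete-at-u
...   | w , ¬edge with u ≟ w | adj G u w in uw
...     | yes refl | _     = ⊥-elim (¬edge (λ u≢u → ⊥-elim (u≢u refl)))
...     | no _     | true  = ⊥-elim (¬edge (λ _ → refl))
...     | no u≢w   | false = u , w , u≢w , uw

corollary1 : ∀ {n} (G : Graph n) (k l m : ℕ) → IsStronglyRegular G k l m →
    m ≥ 1 → ¬ IsStar G → rc≤ G 5
corollary1 G k l m (_ , notComplete , regular , adjacent-common , nonadjacent-common) m≥1 _
  with non-edge G notComplete
... | v , u0 , v≢u0 , vu0 = 5 , ≤-refl , colouring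
  where
    open StronglyRegular G regular adjacent-common nonadjacent-common
    open AroundNonEdge m≥1 v≢u0 vu0

    colouring : Σ (EdgeColouring G 5) RainbowConnecting
    colouring with m ≟ℕ 1 | l ≟ℕ 0
    ... | yes m≡1 | _       = UniqueCommon.colouring m≡1
    ... | no _    | yes l≡0 = TriangleFree.colouring l≡0
    ... | no m≢1  | no l≢0  = TwoCommon.colouring (n≢0⇒n>0 l≢0) (≤∧≢⇒< m≥1 (≢-sym m≢1))
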